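{- Let $H$ and $F$ be $r$-uniform hypergraphs. The following are equivalent: (1) there is a homomorphism from $H$ to $F$; (2) there exists a function $g : i(F) \to i(H)$ such that the family \[ \left\{ A_x = \bigcap_{I \in i(F),\ x \in I} g(I) \ :\ x \in V(F) \right\} \] covers $V(H)$.
   Context: A hypergraph has a finite vertex set and a set of subsets (edges); it is $r$-uniform if all edges have size $r$. A set of vertices is independent if it contains no edge; $i(H)$ is the set of all inclusion-maximal independent sets of $H$. A map $f : V(H) \to V(F)$ is a homomorphism if for every edge $h$ of $H$, the image $f(h)$ is an edge of $F$. An intersection over an empty family of subsets of $V(H)$ is taken to be $V(H)$. A family of sets covers $V(H)$ if its union contains $V(H)$. -}

module Defs where

open import Data.Nat using (ℕ)
open import Data.Bool using (Bool; true; false; _∧_)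
open import Data.Fin using (Fin; _≟_)
open import Data.Fin.Subset using (Subset; _∈_; _∉_; _⊆_; ∣_∣)
open import Data.Vec using (tabulate; lookup)
open import Data.List using (List; allFin)
open import Data.Bool.ListAction using (any)
open import Data.List.Relation.Unary.All using (All)
open import Data.List.Relation.Unary.Any using (Any)
open import Data.Product using (Σ; ∃; _×_)
open import Relation.Nullary using (¬_; does)
open import Relation.Binary.PropositionalEquality using (_≡_)
import Data.List.Membership.Propositional as LM

-- A hypergraph on the vertex set Fin n; edges are subsets of the vertex set,
-- given as a finite list (repetitions are harmless).
record Hypergraph : Set where
  field
    n     : ℕ
    edges : List (Subset n)
open Hypergraph public

V : Hypergraph → Set
V H = Fin (n H)

Uniform : ℕ → Hypergraph → Set
Uniform r H = All (λ e → ∣ e ∣ ≡ r) (edges H)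

Independent : (H : Hypergraph) → Subset (n H) → Set
Independent H S = ¬ Any (λ e → e ⊆ S) (edges H)

MaxIndependent : (H : Hypergraph) → Subset (n H) → Set
MaxIndependent H S =
  Independent H S × (∀ T → Independent H T → S ⊆ T → T ⊆ S)

image : ∀ {a b} → (Fin a → Fin b) → Subset a → Subset b
image {a} f h = tabulate (λ y → any (λ x → lookup h x ∧ does (f x ≟ y)) (allFin a))

Homomorphism : (H F : Hypergraph) → (V H → V F) → Set
Homomorphism H F f = All (λ h → image f h LM.∈ edges F) (edges H)

-- A_x = ⋂ { g(I) : I ∈ i(F), x ∈ I }  (empty intersection = V(H)),
-- given as a membership predicate on V(H).
InA : (H F : Hypergraph) → (Subset (n F) → Subset (n H)) → V F → V H → Set
InA H F g x v = ∀ I → MaxIndependent F I → x ∈ I → v ∈ g I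

Covers : (H F : Hypergraph) → (Subset (n F) → Subset (n H)) → Set
Covers H F g = ∀ (v : V H) → ∃ λ (x : V F) → InA H F g x v

-- g : i(F) → i(H), represented as a function on all subsets that maps
-- maximal independent sets of F to maximal independent sets of H
-- (its values elsewhere are never used).
MapsMaxIndep : (H F : Hypergraph) → (Subset (n F) → Subset (n H)) → Set
MapsMaxIndep H F g = ∀ I → MaxIndependent F I → MaxIndependent H (g I)

-- For (1) ⇒ (2), send I ∈ i(F) to any maximal independent set of H containing f⁻¹(I); the
-- preimage is independent because f maps edges to edges, and then v ∈ A_{f v} for every v.
-- For (2) ⇒ (1), let f v be any x with v ∈ A_x. If f(h) were independent for an edge h of H,
-- extending it to some I ∈ i(F) would give h ⊆ g(I), contradicting independence of g(I).
-- So f(h) contains an edge e of F, and r = |e| ≤ |f(h)| ≤ |h| = r forces f(h) = e.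
module Submission where

open import Defs
open import Data.Nat using (ℕ; suc; _+_; _≤_; z≤n; s≤s)
open import Data.Nat.Properties
  using (module ≤-Reasoning; ≤-trans; ≤-reflexive; n≤1+n; +-monoʳ-≤; +-suc; <⇒≱)
open import Data.Bool using (Bool; T)
open import Data.Bool.Properties using (T-≡; T-∧)
open import Data.Fin using (Fin; zero; suc; _≟_)
open import Data.Fin.Subset
  using (Subset; ⊥; _∈_; _⊆_; _∪_; ⁅_⁆; ∣_∣; inside; outside)
open import Data.Fin.Subset.Properties
  using ( x∈p∪q⁻; p⊆p∪q; q⊆p∪q; x∈⁅x⁆; x∈⁅y⁆⇒x≡y; ∣⁅x⁆∣≡1; ∣⊥∣≡0; _∈?_; _⊆?_
        ; ⊆-antisym; p⊆q⇒∣p∣≤∣q∣; p⊂q⇒∣p∣<∣q∣ )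
open import Data.Vec using ([]; _∷_; here; there; tabulate; lookup)
open import Data.Vec.Properties using (lookup∘tabulate; []=⇒lookup; lookup⇒[]=)
open import Data.List using (List; []; _∷_; foldr; allFin)
import Data.List.Relation.Unary.All as All
open import Data.List.Relation.Unary.Any as Any using (Any)
open import Data.List.Relation.Unary.Any.Properties using (any⁺; any⁻)
open import Data.List.Membership.Propositional using (lose; find)
open import Data.List.Membership.Propositional.Properties using (∈-allFin)
import Data.List.Membership.Propositional as List
open import Data.Product using (∃; _×_; _,_; proj₁; proj₂)
open import Data.Sum using (_⊎_; inj₁; inj₂; [_,_])
open import Level using (0ℓ)
open import Function using (_∘_)
open import Function.Bundles using (_⇔_; mk⇔; Equivalence)
open import Relation.Nullary using (¬_; ¬?; yes; no; does; contradiction)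
open import Relation.Nullary.Decidable using (toWitness; fromWitness; isYes≗does; decidable-stable)
open import Relation.Unary using (Pred; Decidable)
open import Relation.Binary.PropositionalEquality using (_≡_; refl; sym; trans; cong; subst)

private
  variable
    a b m : ℕ

∈-tabulate⁺ : {P : Fin m → Bool} {x : Fin m} → T (P x) → x ∈ tabulate P
∈-tabulate⁺ {P = P} {x} px =
  lookup⇒[]= x (tabulate P)
    (subst (_≡ _) (sym (lookup∘tabulate P x)) (Equivalence.to T-≡ px))

∈-tabulate⁻ : {P : Fin m → Bool} {x : Fin m} → x ∈ tabulate P → T (P x)
∈-tabulate⁻ {P = P} {x} x∈ =
  Equivalence.from T-≡ (subst (_≡ _) (lookup∘tabulate P x) ([]=⇒lookup x∈))

∈⇒T-lookup : {p : Subset m} {x : Fin m} → x ∈ p → T (lookup p x)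
∈⇒T-lookup x∈p = Equivalence.from T-≡ ([]=⇒lookup x∈p)

T-lookup⇒∈ : {p : Subset m} {x : Fin m} → T (lookup p x) → x ∈ p
T-lookup⇒∈ {p = p} {x} t = lookup⇒[]= x p (Equivalence.to T-≡ t)

∪-least : {p q r : Subset m} → p ⊆ r → q ⊆ r → p ∪ q ⊆ r
∪-least {p = p} {q} p⊆r q⊆r x∈ = [ p⊆r , q⊆r ] (x∈p∪q⁻ p q x∈)

⁅x⁆⊆p : {x : Fin m} {p : Subset m} → x ∈ p → ⁅ x ⁆ ⊆ p
⁅x⁆⊆p {x = x} x∈p y∈ = subst (_∈ _) (sym (x∈⁅y⁆⇒x≡y x y∈)) x∈p

∈-image⁺ : (f : Fin a → Fin b) {h : Subset a} {x : Fin a} → x ∈ h → f x ∈ image f h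
∈-image⁺ f {x = x} x∈h =
  ∈-tabulate⁺ (any⁺ _ (lose (∈-allFin x) (Equivalence.from T-∧ (∈⇒T-lookup x∈h , fx≟fx))))
  where
  fx≟fx : T (does (f x ≟ f x))
  fx≟fx = subst T (isYes≗does (f x ≟ f x)) (fromWitness refl)

∈-image⁻ : (f : Fin a → Fin b) {h : Subset a} {y : Fin b} →
           y ∈ image f h → ∃ λ x → x ∈ h × f x ≡ y
∈-image⁻ {a} f {y = y} y∈ with find (any⁻ _ (allFin a) (∈-tabulate⁻ y∈))
... | x , _ , t with Equivalence.to T-∧ t
...   | x∈h , fx≡y = x , T-lookup⇒∈ x∈h , toWitness (subst T (sym (isYes≗does (f x ≟ y))) fx≡y)

image-⊆ : (f : Fin a → Fin b) (h : Subset a) {S : Subset b} →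
          (∀ {x} → x ∈ h → f x ∈ S) → image f h ⊆ S
image-⊆ f h mapsTo y∈ with ∈-image⁻ f y∈
... | x , x∈h , refl = mapsTo x∈h

preimage : (Fin a → Fin b) → Subset b → Subset a
preimage f S = tabulate (λ v → lookup S (f v))

∈-preimage⁺ : (f : Fin a → Fin b) {S : Subset b} {v : Fin a} → f v ∈ S → v ∈ preimage f S
∈-preimage⁺ f fv∈S = ∈-tabulate⁺ (∈⇒T-lookup fv∈S)

∈-preimage⁻ : (f : Fin a → Fin b) {S : Subset b} {v : Fin a} → v ∈ preimage f S → f v ∈ S
∈-preimage⁻ f v∈ = T-lookup⇒∈ (∈-tabulate⁻ v∈)

∣p∪q∣≤∣p∣+∣q∣ : (p q : Subset m) → ∣ p ∪ q ∣ ≤ ∣ p ∣ + ∣ q ∣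
∣p∪q∣≤∣p∣+∣q∣ []            []            = z≤n
∣p∪q∣≤∣p∣+∣q∣ (inside  ∷ p) (inside  ∷ q) =
  s≤s (≤-trans (∣p∪q∣≤∣p∣+∣q∣ p q) (+-monoʳ-≤ ∣ p ∣ (n≤1+n ∣ q ∣)))
∣p∪q∣≤∣p∣+∣q∣ (inside  ∷ p) (outside ∷ q) = s≤s (∣p∪q∣≤∣p∣+∣q∣ p q)
∣p∪q∣≤∣p∣+∣q∣ (outside ∷ p) (inside  ∷ q) =
  ≤-trans (s≤s (∣p∪q∣≤∣p∣+∣q∣ p q)) (≤-reflexive (sym (+-suc ∣ p ∣ ∣ q ∣)))
∣p∪q∣≤∣p∣+∣q∣ (outside ∷ p) (outside ∷ q) = ∣p∪q∣≤∣p∣+∣q∣ p q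

image-[] : (f : Fin 0 → Fin b) → image f [] ⊆ ⊥
image-[] f = image-⊆ f [] λ ()

image-outside∷ : (f : Fin (suc a) → Fin b) (h : Subset a) →
                 image f (outside ∷ h) ⊆ image (f ∘ suc) h
image-outside∷ f h = image-⊆ f (outside ∷ h) λ { (there x∈h) → ∈-image⁺ (f ∘ suc) x∈h }

image-inside∷ : (f : Fin (suc a) → Fin b) (h : Subset a) →
                image f (inside ∷ h) ⊆ ⁅ f zero ⁆ ∪ image (f ∘ suc) h
image-inside∷ f h = image-⊆ f (inside ∷ h) λ
  { here        → p⊆p∪q (image (f ∘ suc) h) (x∈⁅x⁆ (f zero))
  ; (there x∈h) → q⊆p∪q ⁅ f zero ⁆ (image (f ∘ suc) h) (∈-image⁺ (f ∘ suc) x∈h)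
  }

∣image∣≤∣∣ : (f : Fin a → Fin b) (h : Subset a) → ∣ image f h ∣ ≤ ∣ h ∣
∣image∣≤∣∣ {b = b} f [] = begin
  ∣ image f [] ∣  ≤⟨ p⊆q⇒∣p∣≤∣q∣ (image-[] f) ⟩
  ∣ ⊥ {b} ∣       ≡⟨ ∣⊥∣≡0 b ⟩
  0               ∎
  where open ≤-Reasoning
∣image∣≤∣∣ f (outside ∷ h) = begin
  ∣ image f (outside ∷ h) ∣  ≤⟨ p⊆q⇒∣p∣≤∣q∣ (image-outside∷ f h) ⟩
  ∣ image (f ∘ suc) h ∣      ≤⟨ ∣image∣≤∣∣ (f ∘ suc) h ⟩
  ∣ h ∣                      ∎
  where open ≤-Reasoning
∣image∣≤∣∣ f (inside ∷ h) = begin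
  ∣ image f (inside ∷ h) ∣                  ≤⟨ p⊆q⇒∣p∣≤∣q∣ (image-inside∷ f h) ⟩
  ∣ ⁅ f zero ⁆ ∪ image (f ∘ suc) h ∣        ≤⟨ ∣p∪q∣≤∣p∣+∣q∣ ⁅ f zero ⁆ (image (f ∘ suc) h) ⟩
  ∣ ⁅ f zero ⁆ ∣ + ∣ image (f ∘ suc) h ∣    ≡⟨ cong (_+ ∣ image (f ∘ suc) h ∣) (∣⁅x⁆∣≡1 (f zero)) ⟩
  suc ∣ image (f ∘ suc) h ∣                 ≤⟨ s≤s (∣image∣≤∣∣ (f ∘ suc) h) ⟩
  suc ∣ h ∣                                 ∎
  where open ≤-Reasoning

p⊆q∧∣q∣≤∣p∣⇒p≡q : {p q : Subset m} → p ⊆ q → ∣ q ∣ ≤ ∣ p ∣ → p ≡ q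
p⊆q∧∣q∣≤∣p∣⇒p≡q {p = p} {q} p⊆q ∣q∣≤∣p∣ = ⊆-antisym p⊆q q⊆p
  where
  q⊆p : q ⊆ p
  q⊆p {y} y∈q with y ∈? p
  ... | yes y∈p = y∈p
  ... | no  y∉p = contradiction ∣q∣≤∣p∣ (<⇒≱ (p⊂q⇒∣p∣<∣q∣ (p⊆q , y , y∈q , y∉p)))

Maximal : Pred (Subset m) 0ℓ → Subset m → Set
Maximal P S = P S × (∀ T → P T → S ⊆ T → T ⊆ S)

module GreedyExtension {m : ℕ} {P : Pred (Subset m) 0ℓ} (P? : Decidable P)
                       (P-antitone : ∀ {S T} → S ⊆ T → P T → P S) where

  insert : Fin m → Subset m → Subset m
  insert x S with P? (S ∪ ⁅ x ⁆)
  ... | yes _ = S ∪ ⁅ x ⁆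
  ... | no  _ = S

  Blocked : Subset m → Fin m → Set
  Blocked S x = x ∈ S ⊎ ¬ P (S ∪ ⁅ x ⁆)

  Blocked-mono : ∀ {S T x} → S ⊆ T → Blocked S x → Blocked T x
  Blocked-mono S⊆T (inj₁ x∈S)   = inj₁ (S⊆T x∈S)
  Blocked-mono {T = T} {x} S⊆T (inj₂ ¬PS+x) =
    inj₂ (λ PT+x → ¬PS+x (P-antitone (∪-least (λ y∈S → p⊆p∪q ⁅ x ⁆ (S⊆T y∈S))
                                               (q⊆p∪q T ⁅ x ⁆)) PT+x))

  ⊆-insert : ∀ x S → S ⊆ insert x S
  ⊆-insert x S with P? (S ∪ ⁅ x ⁆)
  ... | yes _ = p⊆p∪q ⁅ x ⁆
  ... | no  _ = λ y∈S → y∈S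

  insert-preserves : ∀ x {S} → P S → P (insert x S)
  insert-preserves x {S} PS with P? (S ∪ ⁅ x ⁆)
  ... | yes PS+x = PS+x
  ... | no  _    = PS

  insert-blocks : ∀ x S → Blocked (insert x S) x
  insert-blocks x S with P? (S ∪ ⁅ x ⁆)
  ... | yes _     = inj₁ (q⊆p∪q S ⁅ x ⁆ (x∈⁅x⁆ x))
  ... | no  ¬PS+x = inj₂ ¬PS+x

  insertAll : List (Fin m) → Subset m → Subset m
  insertAll xs S = foldr insert S xs

  ⊆-insertAll : ∀ xs S → S ⊆ insertAll xs S
  ⊆-insertAll []       S y∈S = y∈S
  ⊆-insertAll (x ∷ xs) S y∈S = ⊆-insert x _ (⊆-insertAll xs S y∈S)

  insertAll-preserves : ∀ xs {S} → P S → P (insertAll xs S)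
  insertAll-preserves []       PS = PS
  insertAll-preserves (x ∷ xs) PS = insert-preserves x (insertAll-preserves xs PS)

  insertAll-blocks : ∀ {xs y} S → y List.∈ xs → Blocked (insertAll xs S) y
  insertAll-blocks {x ∷ xs} S (Any.here refl) = insert-blocks x (insertAll xs S)
  insertAll-blocks {x ∷ xs} S (Any.there y∈xs) =
    Blocked-mono (⊆-insert x _) (insertAll-blocks S y∈xs)

  extend : Subset m → Subset m
  extend = insertAll (allFin m)

  ⊆-extend : ∀ S → S ⊆ extend S
  ⊆-extend = ⊆-insertAll (allFin m)

  extend-maximal : ∀ {S} → P S → Maximal P (extend S)
  extend-maximal {S} PS = insertAll-preserves (allFin m) PS , maximality
    where
    maximality : ∀ T → P T → extend S ⊆ T → T ⊆ extend S
    maximality T PT E⊆T {y} y∈T with insertAll-blocks S (∈-allFin y)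
    ... | inj₁ y∈E   = y∈E
    ... | inj₂ ¬PE+y = contradiction (P-antitone (∪-least E⊆T (⁅x⁆⊆p y∈T)) PT) ¬PE+y

ContainsEdge : (H : Hypergraph) → Subset (n H) → Set
ContainsEdge H S = Any (_⊆ S) (edges H)

containsEdge? : (H : Hypergraph) → Decidable (ContainsEdge H)
containsEdge? H S = Any.any? (_⊆? S) (edges H)

independent? : (H : Hypergraph) → Decidable (Independent H)
independent? H S = ¬? (containsEdge? H S)

independent-antitone : (H : Hypergraph) {S T : Subset (n H)} →
                       S ⊆ T → Independent H T → Independent H S
independent-antitone H S⊆T indepT e⊆S =
  indepT (Any.map (λ e⊆S {x} x∈e → S⊆T (e⊆S x∈e)) e⊆S)

edge⊆⇒¬independent : (H : Hypergraph) {e S : Subset (n H)} →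
                     e List.∈ edges H → e ⊆ S → ¬ Independent H S
edge⊆⇒¬independent H e∈H e⊆S indep = indep (lose e∈H e⊆S)

module MaxIndependentExtension (H : Hypergraph) =
  GreedyExtension (independent? H) (independent-antitone H)

preimage-independent : (H F : Hypergraph) {f : V H → V F} → Homomorphism H F f →
                       ∀ {I} → Independent F I → Independent H (preimage f I)
preimage-independent H F {f} hom {I} indepI hasEdge with find hasEdge
... | h , h∈H , h⊆f⁻¹I =
  edge⊆⇒¬independent F (All.lookup hom h∈H)
    (image-⊆ f h (λ x∈h → ∈-preimage⁻ f (h⊆f⁻¹I x∈h))) indepI

uniform-image-edge : ∀ {r} (H F : Hypergraph) → Uniform r H → Uniform r F →
                     (f : V H → V F) {h : Subset (n H)} {e : Subset (n F)} →
                     h List.∈ edges H → e List.∈ edges F → e ⊆ image f h →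
                     image f h List.∈ edges F
uniform-image-edge H F uH uF f {h} {e} h∈H e∈F e⊆fh =
  subst (List._∈ edges F) (p⊆q∧∣q∣≤∣p∣⇒p≡q e⊆fh ∣fh∣≤∣e∣) e∈F
  where
  ∣fh∣≤∣e∣ : ∣ image f h ∣ ≤ ∣ e ∣
  ∣fh∣≤∣e∣ = ≤-trans (∣image∣≤∣∣ f h)
                     (≤-reflexive (trans (All.lookup uH h∈H) (sym (All.lookup uF e∈F))))

homomorphism⇒cover : (H F : Hypergraph) → (∃ λ f → Homomorphism H F f) →
                     ∃ λ g → MapsMaxIndep H F g × Covers H F g
homomorphism⇒cover H F (f , hom) = g , mapsMax , covers
  where
  open MaxIndependentExtension H
  g : Subset (n F) → Subset (n H)
  g I = extend (preimage f I)
  mapsMax : MapsMaxIndep H F g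
  mapsMax I (indepI , _) = extend-maximal (preimage-independent H F hom indepI)
  covers : Covers H F g
  covers v = f v , λ I _ fv∈I → ⊆-extend (preimage f I) (∈-preimage⁺ f fv∈I)

cover⇒homomorphism : ∀ {r} (H F : Hypergraph) → Uniform r H → Uniform r F →
                     (∃ λ g → MapsMaxIndep H F g × Covers H F g) →
                     ∃ λ f → Homomorphism H F f
cover⇒homomorphism H F uH uF (g , mapsMax , covers) = f , All.tabulate image-edge
  where
  open MaxIndependentExtension F
  f : V H → V F
  f v = proj₁ (covers v)
  image-¬independent : ∀ {h} → h List.∈ edges H → ¬ Independent F (image f h)
  image-¬independent {h} h∈H indep =
    edge⊆⇒¬independent H h∈H h⊆gI (proj₁ (mapsMax I maxI))
    where
    I : Subset (n F)
    I = extend (image f h)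
    maxI : MaxIndependent F I
    maxI = extend-maximal indep
    h⊆gI : h ⊆ g I
    h⊆gI {v} v∈h = proj₂ (covers v) I maxI (⊆-extend (image f h) (∈-image⁺ f v∈h))
  image-edge : ∀ {h} → h List.∈ edges H → image f h List.∈ edges F
  image-edge {h} h∈H
    with find (decidable-stable (containsEdge? F (image f h)) (image-¬independent h∈H))
  ... | e , e∈F , e⊆fh = uniform-image-edge H F uH uF f h∈H e∈F e⊆fh

mainTheorem17 : (r : ℕ) (H F : Hypergraph) → Uniform r H → Uniform r F →
    (∃ λ (f : V H → V F) → Homomorphism H F f) ⇔
    (∃ λ (g : Subset (n F) → Subset (n H)) → MapsMaxIndep H F g × Covers H F g)
mainTheorem17 r H F uH uF =
  mk⇔ (homomorphism⇒cover H F) (cover⇒homomorphism H F uH uF)
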